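{- Let $\mathcal{M}=(\mathcal{T},\mathcal{V},\mu)$ be an incremental model and let $(S,P)$ be a process with $S=I\cup O$ computing $F\subseteq[\mathcal{V}_I\to\mathcal{V}_O]$. Let $t\in P$ and $f\in F$ be such that $t$ computes $f$, i.e. $\hat\rho^S_O(t)=f(\hat\rho^S_I(t))$ and $\hat\rho^S_O(v)\sqsubseteq f(\hat\rho^S_I(u))$ for all $u\prec v$ relative to $t$. Then for every $u\sqsubseteq t$ in $\mathcal{T}_S$, \[ \hat\rho^S_O(u)\sqsubseteq f(\hat\rho^S_I(u)). \]
   Context: A cpo is a directed-complete poset with least element; $K(D)$ compact elements, $K(d)$ compact elements below $d$; covering $x\prec y$ means $x\sqsubseteq y$, $x\ne y$, nothing strictly between; $b\prec c$ relative to $d$ means $b,c\in K(d)$ and $b\prec c$. A model $\mathcal{M}=(\mathcal{T},\mathcal{V},\mu)$ over a class of channels (sorts = sets of channels): cpos $\mathcal{T}_S$ with strict continuous restriction maps $\rho^S_T:\mathcal{T}_S\to\mathcal{T}_T$ for $S\supseteq T$ (functorial: $\rho^T_U\circ\rho^S_T=\rho^S_U$, $\rho^S_S=\mathrm{id}$); $\mathcal{V}_S=\prod_{\alpha\in S}\mathcal{V}_{\{\alpha\}}$ with projections $\pi^S_T$; strict continuous $\mu_S:\mathcal{T}_S\to\mathcal{V}_S$ with $\mu_T\circ\rho^S_T=\pi^S_T\circ\mu_S$; $\hat\rho^S_T:=\mu_T\circ\rho^S_T$. The model is incremental if each $\mathcal{T}_S$ is an $\omega$-algebraic cpo in which any $b\sqsubseteq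 c$ in $K(\mathcal{T}_S)$ are joined by a finite chain $b=b_0\prec\cdots\prec b_n=c$, and each $\rho^S_T$ is an incremental morphism: (i) $b\prec c$ relative to $d$ implies $\rho(b)\prec\rho(c)$ relative to $\rho(d)$ or $\rho(b)=\rho(c)\in K(\rho(d))$; (ii) if $b'\prec c'$ relative to $\rho(d)$ then there are $b\prec c$ relative to $d$ with $\rho(b)=b'$, $\rho(c)=c'$. A process is $(S,P)$ with $P\subseteq\mathcal{T}_S$; with $S=I\cup O$ it computes $F\subseteq[\mathcal{V}_I\to\mathcal{V}_O]$ if for all $t\in\mathcal{T}_S$: $t\in P$ iff some $f\in F$ satisfies (1) $\hat\rho^S_O(t)=f(\hat\rho^S_I(t))$ and (2) $\hat\rho^S_O(v)\sqsubseteq f(\hat\rho^S_I(u))$ for all $u\prec v$ relative to $t$. -}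

module Defs where

open import Level using (0ℓ)
open import Data.Nat using (ℕ; zero; suc; _≤_; _<_)
open import Data.Product using (Σ; ∃; _×_; _,_; proj₁; proj₂)
open import Data.Sum using (_⊎_)
open import Relation.Nullary using (¬_)
open import Relation.Binary using (Rel; IsPartialOrder; IsPreorder; IsEquivalence)
open import Relation.Unary using (Pred; _∈_; _⊆_; _∪_)
open import Function.Bundles using (_⇔_)

module _ {A : Set} (_⊑_ : Rel A 0ℓ) where

  record IsDirected {I : Set} (d : I → A) : Set where
    field
      inhabited : I
      upper     : ∀ i j → ∃ λ k → (d i ⊑ d k) × (d j ⊑ d k)

  IsUpperBound : {I : Set} → (I → A) → A → Set
  IsUpperBound d s = ∀ i → d i ⊑ s

  IsLub : {I : Set} → (I → A) → A → Set
  IsLub d s = IsUpperBound d s × (∀ s' → IsUpperBound d s' → s ⊑ s')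

record Cpo : Set₁ where
  infix 4 _≈_ _⊑_
  field
    Carrier        : Set
    _≈_            : Rel Carrier 0ℓ
    _⊑_            : Rel Carrier 0ℓ
    isPartialOrder : IsPartialOrder _≈_ _⊑_
    ⊥              : Carrier
    ⊥-least        : ∀ x → ⊥ ⊑ x
    ⊔              : {I : Set} (d : I → Carrier) → IsDirected _⊑_ d → Carrier
    ⊔-lub          : {I : Set} (d : I → Carrier) (dir : IsDirected _⊑_ d) →
                     IsLub _⊑_ d (⊔ d dir)

module CpoNotions (D : Cpo) where
  open Cpo D

  Compact : Carrier → Set₁
  Compact c = {I : Set} (d : I → Carrier) (dir : IsDirected _⊑_ d) →
              c ⊑ ⊔ d dir → ∃ λ i → c ⊑ d i

  _⊏_ : Rel Carrier 0ℓ
  x ⊏ y = (x ⊑ y) × ¬ (x ≈ y)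

  _≺_ : Rel Carrier 0ℓ
  x ≺ y = (x ⊏ y) × ¬ (∃ λ z → (x ⊏ z) × (z ⊏ y))

  -- b ≺ c relative to d : b, c ∈ K(d) and b ≺ c
  CoversRel : Carrier → Carrier → Carrier → Set₁
  CoversRel b c d = (Compact b × b ⊑ d) × (Compact c × c ⊑ d) × (b ≺ c)

  record IsOmegaAlgebraic : Set₁ where
    field
      e            : ℕ → Carrier
      e-compact    : ∀ n → Compact (e n)
      e-enumerates : ∀ c → Compact c → ∃ λ n → c ≈ e n
      below-dir    : ∀ x → IsDirected _⊑_ {Σ ℕ λ n → e n ⊑ x} (λ p → e (proj₁ p))
      below-lub    : ∀ x → IsLub _⊑_ {Σ ℕ λ n → e n ⊑ x} (λ p → e (proj₁ p)) x

  HasFiniteChains : Set₁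
  HasFiniteChains =
    ∀ b c → Compact b → Compact c → b ⊑ c →
    ∃ λ (n : ℕ) → ∃ λ (ch : ℕ → Carrier) →
      (∀ i → i ≤ n → Compact (ch i)) ×
      (ch 0 ≈ b) × (ch n ≈ c) ×
      (∀ i → i < n → ch i ≺ ch (suc i))

module _ (D E : Cpo) where
  private
    module D = Cpo D
    module E = Cpo E
    module ND = CpoNotions D
    module NE = CpoNotions E

  IsStrict : (D.Carrier → E.Carrier) → Set
  IsStrict f = f D.⊥ E.≈ E.⊥

  record IsContinuous (f : D.Carrier → E.Carrier) : Set₁ where
    field
      monotone : ∀ {x y} → x D.⊑ y → f x E.⊑ f y
      pres-lub : {I : Set} (d : I → D.Carrier) (dir : IsDirected D._⊑_ d) →
                 IsLub E._⊑_ (λ i → f (d i)) (f (D.⊔ d dir))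

  record ContFun : Set₁ where
    field
      fun        : D.Carrier → E.Carrier
      continuous : IsContinuous fun

  record IsIncrementalMorphism (ρ : D.Carrier → E.Carrier) : Set₁ where
    field
      inc-i  : ∀ b c d → ND.CoversRel b c d →
               NE.CoversRel (ρ b) (ρ c) (ρ d)
               ⊎ ((ρ b E.≈ ρ c) × NE.Compact (ρ b) × (ρ b E.⊑ ρ d))
      inc-ii : ∀ d b' c' → NE.CoversRel b' c' (ρ d) →
               ∃ λ b → ∃ λ c → ND.CoversRel b c d × (ρ b E.≈ b') × (ρ c E.≈ c')

Sort : Set → Set₁
Sort Chan = Pred Chan 0ℓ

module Product {Chan : Set} (V₁ : Chan → Cpo) (S : Sort Chan) where
  open Cpo

  Car : Set
  Car = (α : Chan) → α ∈ S → Carrier (V₁ α)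

  _≈ᵖ_ : Rel Car 0ℓ
  u ≈ᵖ v = ∀ α (p : α ∈ S) → _≈_ (V₁ α) (u α p) (v α p)

  _⊑ᵖ_ : Rel Car 0ℓ
  u ⊑ᵖ v = ∀ α (p : α ∈ S) → _⊑_ (V₁ α) (u α p) (v α p)

  isPO : IsPartialOrder _≈ᵖ_ _⊑ᵖ_
  isPO = record
    { isPreorder = record
      { isEquivalence = record
        { refl  = λ α p → IsPartialOrder.Eq.refl (isPartialOrder (V₁ α))
        ; sym   = λ x α p → IsPartialOrder.Eq.sym (isPartialOrder (V₁ α)) (x α p)
        ; trans = λ x y α p → IsPartialOrder.Eq.trans (isPartialOrder (V₁ α)) (x α p) (y α p)
        }
      ; reflexive = λ x α p → IsPartialOrder.reflexive (isPartialOrder (V₁ α)) (x α p)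
      ; trans     = λ x y α p → IsPartialOrder.trans (isPartialOrder (V₁ α)) (x α p) (y α p)
      }
    ; antisym = λ x y α p → IsPartialOrder.antisym (isPartialOrder (V₁ α)) (x α p) (y α p)
    }

  proj-dir : {I : Set} (d : I → Car) → IsDirected _⊑ᵖ_ d →
             ∀ α (p : α ∈ S) → IsDirected (_⊑_ (V₁ α)) (λ i → d i α p)
  proj-dir d dir α p = record
    { inhabited = IsDirected.inhabited dir
    ; upper = λ i j → let (k , x , y) = IsDirected.upper dir i j in k , x α p , y α p
    }

  cpo : Cpo
  cpo = record
    { Carrier = Car
    ; _≈_ = _≈ᵖ_
    ; _⊑_ = _⊑ᵖ_
    ; isPartialOrder = isPO
    ; ⊥ = λ α p → ⊥ (V₁ α)
    ; ⊥-least = λ x α p → ⊥-least (V₁ α) (x α p)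
    ; ⊔ = λ d dir α p → ⊔ (V₁ α) (λ i → d i α p) (proj-dir d dir α p)
    ; ⊔-lub = λ d dir →
        (λ i α p → proj₁ (⊔-lub (V₁ α) (λ j → d j α p) (proj-dir d dir α p)) i)
      , (λ s ub α p → proj₂ (⊔-lub (V₁ α) (λ j → d j α p) (proj-dir d dir α p))
                            (s α p) (λ i → ub i α p))
    }

  π : (U : Sort Chan) → U ⊆ S → Car → ((α : Chan) → α ∈ U → Carrier (V₁ α))
  π U U⊆S v α p = v α (U⊆S p)

record Model (Chan : Set) : Set₁ where
  field
    T       : Sort Chan → Cpo
    ρ       : (S U : Sort Chan) → U ⊆ S → Cpo.Carrier (T S) → Cpo.Carrier (T U)
    ρ-strict : ∀ S U (p : U ⊆ S) → IsStrict (T S) (T U) (ρ S U p)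
    ρ-cont   : ∀ S U (p : U ⊆ S) → IsContinuous (T S) (T U) (ρ S U p)
    ρ-comp   : ∀ S U W (p : U ⊆ S) (q : W ⊆ U) (r : W ⊆ S) x →
               Cpo._≈_ (T W) (ρ U W q (ρ S U p x)) (ρ S W r x)
    ρ-id     : ∀ S (p : S ⊆ S) x → Cpo._≈_ (T S) (ρ S S p x) x
    V₁      : Chan → Cpo          -- V_{α} for the singleton sort {α}

  V : Sort Chan → Cpo
  V S = Product.cpo V₁ S

  π : (S U : Sort Chan) → U ⊆ S → Cpo.Carrier (V S) → Cpo.Carrier (V U)
  π S U p = Product.π V₁ S U p

  field
    μ        : ∀ S → Cpo.Carrier (T S) → Cpo.Carrier (V S)
    μ-strict : ∀ S → IsStrict (T S) (V S) (μ S)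
    μ-cont   : ∀ S → IsContinuous (T S) (V S) (μ S)
    μ-nat    : ∀ S U (p : U ⊆ S) x →
               Cpo._≈_ (V U) (μ U (ρ S U p x)) (π S U p (μ S x))

  ρ̂ : (S U : Sort Chan) → U ⊆ S → Cpo.Carrier (T S) → Cpo.Carrier (V U)
  ρ̂ S U p x = μ U (ρ S U p x)

record IsIncremental {Chan : Set} (M : Model Chan) : Set₁ where
  open Model M
  field
    algebraic : ∀ S → CpoNotions.IsOmegaAlgebraic (T S)
    chains    : ∀ S → CpoNotions.HasFiniteChains (T S)
    ρ-incr    : ∀ S U (p : U ⊆ S) → IsIncrementalMorphism (T S) (T U) (ρ S U p)

module Computation {Chan : Set} (M : Model Chan) (I O : Sort Chan) where
  open Model M

  S : Sort Chan
  S = I ∪ O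

  I⊆S : I ⊆ S
  I⊆S = Data.Sum.inj₁

  O⊆S : O ⊆ S
  O⊆S = Data.Sum.inj₂

  Cond1 : ContFun (V I) (V O) → Cpo.Carrier (T S) → Set
  Cond1 f t = Cpo._≈_ (V O) (ρ̂ S O O⊆S t) (ContFun.fun f (ρ̂ S I I⊆S t))

  Cond2 : ContFun (V I) (V O) → Cpo.Carrier (T S) → Set₁
  Cond2 f t = ∀ u v → CpoNotions.CoversRel (T S) u v t →
              Cpo._⊑_ (V O) (ρ̂ S O O⊆S v) (ContFun.fun f (ρ̂ S I I⊆S u))

  Computes : Pred (Cpo.Carrier (T S)) 0ℓ → Pred (ContFun (V I) (V O)) 0ℓ → Set₁
  Computes P F = ∀ t → P t ⇔ (∃ λ f → F f × Cond1 f t × Cond2 f t)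

-- A compact c below t is either ⊥, where strictness of ρ̂ makes the claim
-- trivial, or the top of a covering step b ≺ c relative to t, where condition
-- (2) and monotonicity of f ∘ ρ̂_I give ρ̂_O(c) ⊑ f(ρ̂_I(b)) ⊑ f(ρ̂_I(c)).
-- An arbitrary u ⊑ t is the directed lub of the compacts below it, and ρ̂_O is
-- continuous, so the inequality passes to u.
module Submission where

open import Defs
open import Level using (0ℓ)
open import Data.Nat using (suc)
open import Data.Nat.Properties using (n≤1+n; n<1+n)
open import Data.Product using (Σ; ∃; _×_; _,_; proj₁; proj₂)
open import Data.Sum using (_⊎_; inj₁; inj₂)
open import Function using (_∘_)
open import Relation.Binary using (IsPartialOrder)
open import Relation.Unary using (Pred; _⊆_)

module CpoProperties (D : Cpo) where
  open Cpo D
  open CpoNotions D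
  open IsPartialOrder isPartialOrder

  ⊥-compact : Compact ⊥
  ⊥-compact d dir _ = IsDirected.inhabited dir , ⊥-least _

  ≺-respʳ-≈ : ∀ {x y z} → x ≺ y → y ≈ z → x ≺ z
  ≺-respʳ-≈ ((x⊑y , x≉y) , gap) y≈z =
      (trans x⊑y (reflexive y≈z) , λ x≈z → x≉y (Eq.trans x≈z (Eq.sym y≈z)))
    , λ { (w , x⊏w , (w⊑z , w≉z)) →
            gap (w , x⊏w , trans w⊑z (reflexive (Eq.sym y≈z))
                         , λ w≈y → w≉z (Eq.trans w≈y y≈z)) }

  compact-≈⊥-or-covers : HasFiniteChains → ∀ {c} → Compact c →
                         c ≈ ⊥ ⊎ ∃ λ b → Compact b × b ≺ c
  compact-≈⊥-or-covers chains {c} cc with chains ⊥ c ⊥-compact cc (⊥-least c)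
  ... | 0 , ch , _ , ch0≈⊥ , ch0≈c , _ = inj₁ (Eq.trans (Eq.sym ch0≈c) ch0≈⊥)
  ... | suc m , ch , compact , _ , chn≈c , steps =
    inj₂ (ch m , compact m (n≤1+n m) , ≺-respʳ-≈ (steps m (n<1+n m)) chn≈c)

  compact-approximation : ∀ {E : Cpo} → CpoNotions.IsOmegaAlgebraic D →
    {g h : Carrier → Cpo.Carrier E} → IsContinuous D E g →
    (∀ {x y} → x ⊑ y → Cpo._⊑_ E (h x) (h y)) →
    ∀ x → (∀ c → Compact c → c ⊑ x → Cpo._⊑_ E (g c) (h c)) →
    Cpo._⊑_ E (g x) (h x)
  compact-approximation {E} alg {g} {h} g-cont h-mono x on-compacts =
    IsPartialOrder.trans (Cpo.isPartialOrder E)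
      (IsContinuous.monotone g-cont x⊑⊔)
      (proj₂ (IsContinuous.pres-lub g-cont approx (below-dir x)) (h x) below)
    where
      open CpoNotions.IsOmegaAlgebraic alg
      approx : Σ _ (λ n → e n ⊑ x) → Carrier
      approx = e ∘ proj₁
      x⊑⊔ : x ⊑ ⊔ approx (below-dir x)
      x⊑⊔ = proj₂ (below-lub x) _ (proj₁ (⊔-lub approx (below-dir x)))
      below : ∀ p → Cpo._⊑_ E (g (approx p)) (h x)
      below (n , en⊑x) = IsPartialOrder.trans (Cpo.isPartialOrder E)
        (on-compacts (e n) (e-compact n) en⊑x) (h-mono en⊑x)

module _ {D E : Cpo} where
  private
    module D = Cpo D
    module E = Cpo E

  continuous-resp-≈ : {g : D.Carrier → E.Carrier} → IsContinuous D E g →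
                    ∀ {x y} → x D.≈ y → g x E.≈ g y
  continuous-resp-≈ g-cont x≈y = IsPartialOrder.antisym E.isPartialOrder
    (mono (IsPartialOrder.reflexive D.isPartialOrder x≈y))
    (mono (IsPartialOrder.reflexive D.isPartialOrder
            (IsPartialOrder.Eq.sym D.isPartialOrder x≈y)))
    where mono = IsContinuous.monotone g-cont

  image-directed : {g : D.Carrier → E.Carrier} → IsContinuous D E g →
                   {J : Set} {d : J → D.Carrier} →
                   IsDirected D._⊑_ d → IsDirected E._⊑_ (g ∘ d)
  image-directed g-cont dir = record
    { inhabited = IsDirected.inhabited dir
    ; upper = λ i j → let (k , i⊑k , j⊑k) = IsDirected.upper dir i j
                      in k , mono i⊑k , mono j⊑k
    }
    where mono = IsContinuous.monotone g-cont

module _ {D E F : Cpo} {g : Cpo.Carrier D → Cpo.Carrier E}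
         {h : Cpo.Carrier E → Cpo.Carrier F} where
  private
    module D = Cpo D
    module E = Cpo E
    module F = Cpo F

  ∘-continuous : IsContinuous D E g → IsContinuous E F h → IsContinuous D F (h ∘ g)
  ∘-continuous g-cont h-cont = record
    { monotone = mono
    ; pres-lub = λ d dir →
        (λ i → mono (proj₁ (D.⊔-lub d dir) i))
        , λ s ub → IsPartialOrder.trans F.isPartialOrder
            (IsContinuous.monotone h-cont (g⊔⊑⊔g d dir))
            (proj₂ (IsContinuous.pres-lub h-cont (g ∘ d) (image-directed g-cont dir)) s ub)
    }
    where
      mono : ∀ {x y} → x D.⊑ y → h (g x) F.⊑ h (g y)
      mono = IsContinuous.monotone h-cont ∘ IsContinuous.monotone g-cont
      g⊔⊑⊔g : ∀ {J} (d : J → D.Carrier) (dir : IsDirected D._⊑_ d) →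
              g (D.⊔ d dir) E.⊑ E.⊔ (g ∘ d) (image-directed g-cont dir)
      g⊔⊑⊔g d dir = proj₂ (IsContinuous.pres-lub g-cont d dir) _
                      (proj₁ (E.⊔-lub (g ∘ d) (image-directed g-cont dir)))

  ∘-strict : IsContinuous E F h → IsStrict D E g → IsStrict E F h →
             IsStrict D F (h ∘ g)
  ∘-strict h-cont g-strict h-strict =
    IsPartialOrder.Eq.trans F.isPartialOrder (continuous-resp-≈ h-cont g-strict) h-strict

module ModelProperties {Chan : Set} (M : Model Chan) where
  open Model M

  ρ̂-continuous : ∀ S U (p : U ⊆ S) → IsContinuous (T S) (V U) (ρ̂ S U p)
  ρ̂-continuous S U p = ∘-continuous (ρ-cont S U p) (μ-cont U)

  ρ̂-strict : ∀ S U (p : U ⊆ S) → IsStrict (T S) (V U) (ρ̂ S U p)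
  ρ̂-strict S U p = ∘-strict {D = T S} {g = ρ S U p} (μ-cont U) (ρ-strict S U p) (μ-strict U)

module ComputationProperties {Chan : Set} (M : Model Chan) (I O : Sort Chan)
                             (f : ContFun (Model.V M I) (Model.V M O)) where
  open Model M
  open Computation M I O
  open ModelProperties M
  open CpoNotions (T S)
  private
    module TS = Cpo (T S)
    module VO = Cpo (V O)
    module VO-≤ = IsPartialOrder VO.isPartialOrder

  out : TS.Carrier → VO.Carrier
  out = ρ̂ S O O⊆S

  f∘in : TS.Carrier → VO.Carrier
  f∘in = ContFun.fun f ∘ ρ̂ S I I⊆S

  f∘in-monotone : ∀ {x y} → x TS.⊑ y → f∘in x VO.⊑ f∘in y
  f∘in-monotone = IsContinuous.monotone
    (∘-continuous (ρ̂-continuous S I I⊆S) (ContFun.continuous f))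

  out-below-⊥ : ∀ {c} → c TS.≈ TS.⊥ → ∀ y → out c VO.⊑ y
  out-below-⊥ c≈⊥ y = VO-≤.trans
    (VO-≤.reflexive (VO-≤.Eq.trans (continuous-resp-≈ (ρ̂-continuous S O O⊆S) c≈⊥)
                                   (ρ̂-strict S O O⊆S)))
    (VO.⊥-least y)

  Cond2⇒compact-out⊑f∘in : HasFiniteChains → ∀ {t} → Cond2 f t →
                           ∀ c → Compact c → c TS.⊑ t → out c VO.⊑ f∘in c
  Cond2⇒compact-out⊑f∘in chains {t} cond2 c cc c⊑t
    with CpoProperties.compact-≈⊥-or-covers (T S) chains cc
  ... | inj₁ c≈⊥ = out-below-⊥ c≈⊥ (f∘in c)
  ... | inj₂ (b , bc , b≺c) =
    VO-≤.trans (cond2 b c ((bc , b⊑t) , (cc , c⊑t) , b≺c)) (f∘in-monotone b⊑c)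
    where
      b⊑c = proj₁ (proj₁ b≺c)
      b⊑t = IsPartialOrder.trans TS.isPartialOrder b⊑c c⊑t

lemma1 : {Chan : Set} (M : Model Chan) → IsIncremental M →
    (I O : Sort Chan) →
    let open Model M
        open Computation M I O
    in (P : Pred (Cpo.Carrier (T S)) 0ℓ) (F : Pred (ContFun (V I) (V O)) 0ℓ) →
       Computes P F →
       (t : Cpo.Carrier (T S)) → P t →
       (f : ContFun (V I) (V O)) → F f →
       Cond1 f t → Cond2 f t →
       (u : Cpo.Carrier (T S)) → Cpo._⊑_ (T S) u t →
       Cpo._⊑_ (V O) (ρ̂ S O O⊆S u) (ContFun.fun f (ρ̂ S I I⊆S u))
lemma1 M inc I O _ _ _ t _ f _ _ cond2 u u⊑t =
  CpoProperties.compact-approximation (T S) (algebraic S)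
    (ρ̂-continuous S O O⊆S) f∘in-monotone u
    (λ c cc c⊑u → Cond2⇒compact-out⊑f∘in (chains S) cond2 c cc (⊑-trans c⊑u u⊑t))
  where
    open Model M
    open Computation M I O
    open IsIncremental inc
    open ModelProperties M
    open ComputationProperties M I O f
    ⊑-trans = IsPartialOrder.trans (Cpo.isPartialOrder (T S))
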